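{- The class $\mathsf{RDInFL}$ of representable distributive involutive FL-algebras is closed under ultraproducts: $\mathbb P_{\mathbb U}(\mathsf{RDInFL})=\mathsf{RDInFL}$, where $\mathbb P_{\mathbb U}(\mathsf K)$ denotes the class of all ultraproducts of families of members of $\mathsf K$.
   Context: A distributive involutive FL-algebra (DInFL-algebra) is a distributive residuated lattice $\langle A,\wedge,\vee,\cdot,1,\backslash,/\rangle$ with a distinguished element $0$ such that ${\sim}a:=a\backslash 0$ and $-a:=0/a$ satisfy $-{\sim}a=a={\sim}{ - }a$; it is regarded in the signature $\langle A,\wedge,\vee,\cdot,1,{\sim},-\rangle$. Concrete algebras: let $\langle X,\le\rangle$ be a poset, $E$ an equivalence relation on $X$ with ${\le}\subseteq E$, and $\alpha$ an order automorphism of $\langle X,\le\rangle$ with $\alpha\subseteq E$. Order $E$ by $(u,v)\preceq(x,y)$ iff $x\le u$ and $v\le y$. With $R^c=E\setminus R$, $R^\smile$ the converse and $\circ$ relational composition, $\mathfrak D(\mathbf E)=\langle \mathsf{Up}(\langle E,\preceq\rangle),\cap,\cup,\circ,\le,{\sim},-\rangle$, where ${\sim}R=R^{c\smile}\circ\alpha$, $-R=\alpha\circ R^{c\smile}$, is a DInFL-algebra. A DInFL-algebra is representable if it is isomorphic to a subalgebra of some $\mathfrak D(\mathbf E)$ of this form (equivalently it lies in $\mathbb{ISP}$ of those with $E=X^2$). -}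

module Defs where

open import Level using (Level; _⊔_; suc; Lift)
open import Data.Unit using (⊤)
open import Data.Empty using (⊥)
open import Data.Product using (Σ; Σ-syntax; ∃; _×_; _,_)
open import Data.Sum using (_⊎_)
open import Relation.Nullary using (¬_)
open import Relation.Binary using (Rel; IsPartialOrder; IsEquivalence)

-- Algebras in the signature ⟨∧, ∨, ·, 1, ∼, −⟩ (a setoid carrier with
-- the operations; no laws are imposed: membership in RDInFL is given by
-- representability, and every 𝔇(𝐄) is a DInFL-algebra).

record RawDInFL (ℓ : Level) : Set (suc ℓ) where
  infixr 7 _·_
  infixr 6 _∧_
  infixr 5 _∨_
  infix 4 _≈_
  field
    Carrier : Set ℓ
    _≈_     : Rel Carrier ℓ
    _∧_     : Carrier → Carrier → Carrier
    _∨_     : Carrier → Carrier → Carrier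
    _·_     : Carrier → Carrier → Carrier
    one     : Carrier
    ∼_      : Carrier → Carrier
    −_      : Carrier → Carrier

module _ {ℓ : Level} {I : Set ℓ} where

  _⊆ᴵ_ : (I → Set ℓ) → (I → Set ℓ) → Set ℓ
  S ⊆ᴵ T = ∀ j → S j → T j

  record IsUltrafilter (U : (I → Set ℓ) → Set ℓ) : Set (suc ℓ) where
    field
      whole  : U (λ _ → Lift ℓ ⊤)
      proper : ¬ U (λ _ → Lift ℓ ⊥)
      upward : ∀ {S T} → S ⊆ᴵ T → U S → U T
      meet   : ∀ {S T} → U S → U T → U (λ j → S j × T j)
      ultra  : ∀ S → U S ⊎ U (λ j → ¬ S j)

Ultraproduct : ∀ {ℓ} (I : Set ℓ) (U : (I → Set ℓ) → Set ℓ) →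
               (I → RawDInFL ℓ) → RawDInFL ℓ
Ultraproduct I U A = record
  { Carrier = (j : I) → RawDInFL.Carrier (A j)
  ; _≈_     = λ f g → U (λ j → RawDInFL._≈_ (A j) (f j) (g j))
  ; _∧_     = λ f g j → RawDInFL._∧_ (A j) (f j) (g j)
  ; _∨_     = λ f g j → RawDInFL._∨_ (A j) (f j) (g j)
  ; _·_     = λ f g j → RawDInFL._·_ (A j) (f j) (g j)
  ; one     = λ j → RawDInFL.one (A j)
  ; ∼_      = λ f j → RawDInFL.∼_ (A j) (f j)
  ; −_      = λ f j → RawDInFL.−_ (A j) (f j)
  }

record Frame (ℓ : Level) : Set (suc ℓ) where
  field
    X       : Set ℓ
    _≈X_    : Rel X ℓ
    _≤_     : Rel X ℓ
    isPO    : IsPartialOrder _≈X_ _≤_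
    E       : Rel X ℓ
    E-equiv : IsEquivalence E
    ≤⊆E     : ∀ {x y} → x ≤ y → E x y
    α       : X → X
    α-cong  : ∀ {x y} → x ≈X y → α x ≈X α y
    α-mono  : ∀ {x y} → x ≤ y → α x ≤ α y
    α-refl  : ∀ {x y} → α x ≤ α y → x ≤ y
    α-surj  : ∀ y → Σ X (λ x → α x ≈X y)
    α⊆E     : ∀ x → E x (α x)

  αʳ : Rel X ℓ
  αʳ x y = α x ≈X y

  IsUp : Rel X ℓ → Set ℓ
  IsUp R = (∀ x y → R x y → E x y)
         × (∀ u v x y → R u v → E x y → x ≤ u → v ≤ y → R x y)

  _∩ʳ_ : Rel X ℓ → Rel X ℓ → Rel X ℓ
  (R ∩ʳ S) x y = R x y × S x y

  _∪ʳ_ : Rel X ℓ → Rel X ℓ → Rel X ℓ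
  (R ∪ʳ S) x y = R x y ⊎ S x y

  _∘ʳ_ : Rel X ℓ → Rel X ℓ → Rel X ℓ
  (R ∘ʳ S) x y = ∃ λ z → R x z × S z y

  _ᶜ : Rel X ℓ → Rel X ℓ
  (R ᶜ) x y = E x y × ¬ R x y

  _⌣ : Rel X ℓ → Rel X ℓ
  (R ⌣) x y = R y x

  ∼ʳ : Rel X ℓ → Rel X ℓ
  ∼ʳ R = ((R ᶜ) ⌣) ∘ʳ αʳ

  −ʳ : Rel X ℓ → Rel X ℓ
  −ʳ R = αʳ ∘ʳ ((R ᶜ) ⌣)

  _≐_ : Rel X ℓ → Rel X ℓ → Set ℓ
  R ≐ S = ∀ x y → (R x y → S x y) × (S x y → R x y)

record IsEmbedding {ℓ} (A : RawDInFL ℓ) (F : Frame ℓ)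
       (h : RawDInFL.Carrier A → Rel (Frame.X F) ℓ) : Set (suc ℓ) where
  open RawDInFL A
  open Frame F
  field
    up      : ∀ a → IsUp (h a)
    cong    : ∀ a b → a ≈ b → h a ≐ h b
    inj     : ∀ a b → h a ≐ h b → a ≈ b
    hom-∧   : ∀ a b → h (a ∧ b) ≐ (h a ∩ʳ h b)
    hom-∨   : ∀ a b → h (a ∨ b) ≐ (h a ∪ʳ h b)
    hom-·   : ∀ a b → h (a · b) ≐ (h a ∘ʳ h b)
    hom-one : h one ≐ _≤_
    hom-∼   : ∀ a → h (∼ a) ≐ ∼ʳ (h a)
    hom-−   : ∀ a → h (− a) ≐ −ʳ (h a)

Representable : ∀ {ℓ} → RawDInFL ℓ → Set (suc ℓ)
Representable {ℓ} A =
  Σ (Frame ℓ) λ F → Σ (RawDInFL.Carrier A → Rel (Frame.X F) ℓ) λ h →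
    IsEmbedding A F h

record Iso {ℓ} (A B : RawDInFL ℓ) : Set ℓ where
  module A = RawDInFL A
  module B = RawDInFL B
  field
    f       : A.Carrier → B.Carrier
    cong    : ∀ a b → a A.≈ b → f a B.≈ f b
    inj     : ∀ a b → f a B.≈ f b → a A.≈ b
    surj    : ∀ b → Σ A.Carrier (λ a → f a B.≈ b)
    hom-∧   : ∀ a b → f (a A.∧ b) B.≈ (f a B.∧ f b)
    hom-∨   : ∀ a b → f (a A.∨ b) B.≈ (f a B.∨ f b)
    hom-·   : ∀ a b → f (a A.· b) B.≈ (f a B.· f b)
    hom-one : f A.one B.≈ B.one
    hom-∼   : ∀ a → f (A.∼ a) B.≈ (B.∼ f a)
    hom-−   : ∀ a → f (A.− a) B.≈ (B.− f a)

-- Representations hⱼ : Aⱼ → 𝔇(Fⱼ) of the factors assemble into one of the ultraproduct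
-- in the manner of Łoś: the frame is the ultraproduct of the Fⱼ (a relation holds when it
-- holds on a U-large set of coordinates) and a ↦ "hⱼ (a j) holds U-almost everywhere".
-- Each clause of the embedding transfers coordinatewise; the existential ones (composition,
-- ∼, −, and injectivity) need a witness in every coordinate, chosen by excluded middle.
-- As factors may have empty frames, an isolated point is first adjoined to every Fⱼ and the
-- carrier is cut down to the elements avoiding it U-almost everywhere.  Conversely each
-- algebra is its own ultrapower by the principal ultrafilter on a one-point set.

module Submission where

open import Defs
open import Level using (Level; Lift; lift; lower)
open import Data.Unit using (⊤; tt)
open import Data.Product using (Σ; _×_; _,_; proj₁; proj₂)
open import Data.Sum as Sum using (_⊎_; inj₁; inj₂)
open import Data.Empty using (⊥-elim)
open import Function using (_∘_; _on_)
open import Data.Maybe using (Maybe; just; nothing)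
import Data.Maybe as Maybe
open import Data.Maybe.Relation.Binary.Pointwise as Pointwise using (Pointwise; just; nothing)
open import Relation.Nullary using (¬_; Dec; yes; no)
open import Relation.Nullary.Decidable using (toSum)
open import Relation.Binary using (Rel; IsEquivalence; IsPartialOrder)
import Relation.Binary.Construct.On as On
open import Axiom.ExcludedMiddle using (ExcludedMiddle)
open import Axiom.DoubleNegationElimination using (DoubleNegationElimination; em⇒dne)

module UltrafilterProperties {ℓ} {I : Set ℓ} {U : (I → Set ℓ) → Set ℓ}
                             (isU : IsUltrafilter U) where
  open IsUltrafilter isU public

  everywhere : {S : I → Set ℓ} → (∀ j → S j) → U S
  everywhere s = upward (λ j _ → s j) whole

  upward₂ : {S T R : I → Set ℓ} → (∀ j → S j → T j → R j) → U S → U T → U R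
  upward₂ f s t = upward (λ j (p , q) → f j p q) (meet s t)

  upward₃ : {S T R Q : I → Set ℓ} → (∀ j → S j → T j → R j → Q j) →
            U S → U T → U R → U Q
  upward₃ f s t r = upward₂ (λ j (p , q) → f j p q) (meet s t) r

  upward₄ : {S T R Q P : I → Set ℓ} → (∀ j → S j → T j → R j → Q j → P j) →
            U S → U T → U R → U Q → U P
  upward₄ f s t r q = upward₃ (λ j (p , p′) → f j p p′) (meet s t) r q

  ¬-large : {S : I → Set ℓ} → U (λ j → ¬ S j) → ¬ U S
  ¬-large n s = proper (upward₂ (λ j ¬p p → lift (¬p p)) n s)

  large-¬ : {S : I → Set ℓ} → ¬ U S → U (λ j → ¬ S j)
  large-¬ {S} ¬s with ultra S
  ... | inj₁ s = ⊥-elim (¬s s)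
  ... | inj₂ n = n

  large-∖ : {S T : I → Set ℓ} → U (λ j → S j × ¬ T j) → U S × ¬ U T
  large-∖ s = upward (λ j → proj₁) s , ¬-large (upward (λ j → proj₂) s)

  large-⊎ : {S T : I → Set ℓ} → U (λ j → S j ⊎ T j) → U S ⊎ U T
  large-⊎ {S} s⊎t with ultra S
  ... | inj₁ s = inj₁ s
  ... | inj₂ n = inj₂ (upward₂ (λ { j (inj₁ p) ¬p → ⊥-elim (¬p p) ; j (inj₂ q) _ → q })
                               s⊎t n)

  choice : ExcludedMiddle ℓ → {Y : I → Set ℓ} {Q : ∀ j → Y j → Set ℓ} →
           (∀ j → Y j) → U (λ j → Σ (Y j) (Q j)) →
           Σ (∀ j → Y j) λ y → U (λ j → Q j (y j))
  choice em {Y} {Q} default s = (λ j → pick j em) , upward (λ j → pick-satisfies j em) s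
    where
    pick : ∀ j → Dec (Σ (Y j) (Q j)) → Y j
    pick j (yes (y , _)) = y
    pick j (no _)        = default j

    pick-satisfies : ∀ j (d : Dec (Σ (Y j) (Q j))) → Σ (Y j) (Q j) → Q j (pick j d)
    pick-satisfies j (yes (_ , q)) _ = q
    pick-satisfies j (no ¬w)       w = ⊥-elim (¬w w)

module _ {ℓ} {A : Set ℓ} where

  data IsJust : Maybe A → Set ℓ where
    just : ∀ {x} → IsJust (just x)

  isJust-map : ∀ {f : A → A} {m} → IsJust m → IsJust (Maybe.map f m)
  isJust-map just = just

  isJust-map⁻ : ∀ {f : A → A} {m} → IsJust (Maybe.map f m) → IsJust m
  isJust-map⁻ {m = just _} just = just

  module _ {R : Rel A ℓ} where

    pointwise-isJustʳ : ∀ {m n} → Pointwise R m n → IsJust m → IsJust n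
    pointwise-isJustʳ (just _) just = just

    pointwise-isJustˡ : ∀ {m n} → Pointwise R m n → IsJust n → IsJust m
    pointwise-isJustˡ (just _) just = just

    pointwise-map : ∀ {S : Rel A ℓ} → (∀ {x y} → R x y → S x y) →
                    ∀ {m n} → Pointwise R m n → Pointwise S m n
    pointwise-map f (just r) = just (f r)
    pointwise-map f nothing  = nothing

_⊖_ : ∀ {ℓ} {A : Set ℓ} → Rel A ℓ → Rel A ℓ → Rel A ℓ
(R ⊖ S) x y = (R x y × ¬ S x y) ⊎ (S x y × ¬ R x y)

pointwise-⊖-isJust : ∀ {ℓ} {A : Set ℓ} {R S : Rel A ℓ} {m n} →
                     (Pointwise R ⊖ Pointwise S) m n → IsJust m × IsJust n
pointwise-⊖-isJust (inj₁ (just _ , _))   = just , just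
pointwise-⊖-isJust (inj₁ (nothing , ¬s)) = ⊥-elim (¬s nothing)
pointwise-⊖-isJust (inj₂ (just _ , _))   = just , just
pointwise-⊖-isJust (inj₂ (nothing , ¬r)) = ⊥-elim (¬r nothing)

module _ {ℓ} (F : Frame ℓ) where
  open Frame F
  private module PO = IsPartialOrder isPO

  adjoinPoint : Frame ℓ
  adjoinPoint = record
    { X       = Maybe X
    ; _≈X_    = Pointwise _≈X_
    ; _≤_     = Pointwise _≤_
    ; isPO    = record
      { isPreorder = record
        { isEquivalence = Pointwise.isEquivalence PO.isEquivalence
        ; reflexive     = pointwise-map PO.reflexive
        ; trans         = Pointwise.trans PO.trans
        }
      ; antisym    = antisym⁺
      }
    ; E       = Pointwise E
    ; E-equiv = Pointwise.isEquivalence E-equiv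
    ; ≤⊆E     = pointwise-map ≤⊆E
    ; α       = Maybe.map α
    ; α-cong  = map-preserves α-cong
    ; α-mono  = map-preserves α-mono
    ; α-refl  = map-reflects
    ; α-surj  = surj⁺
    ; α⊆E     = α⊆E⁺
    }
    where
    antisym⁺ : ∀ {m n} → Pointwise _≤_ m n → Pointwise _≤_ n m → Pointwise _≈X_ m n
    antisym⁺ (just p) (just q) = just (PO.antisym p q)
    antisym⁺ nothing  nothing  = nothing

    map-preserves : ∀ {R : Rel X ℓ} → (∀ {x y} → R x y → R (α x) (α y)) →
                    ∀ {m n} → Pointwise R m n → Pointwise R (Maybe.map α m) (Maybe.map α n)
    map-preserves f (just r) = just (f r)
    map-preserves f nothing  = nothing

    map-reflects : ∀ {m n} → Pointwise _≤_ (Maybe.map α m) (Maybe.map α n) →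
                   Pointwise _≤_ m n
    map-reflects {just _}  {just _}  (just p) = just (α-refl p)
    map-reflects {nothing} {nothing} nothing  = nothing

    surj⁺ : ∀ n → Σ (Maybe X) λ m → Pointwise _≈X_ (Maybe.map α m) n
    surj⁺ (just y) = just (proj₁ (α-surj y)) , just (proj₂ (α-surj y))
    surj⁺ nothing  = nothing , nothing

    α⊆E⁺ : ∀ m → Pointwise E m (Maybe.map α m)
    α⊆E⁺ (just x) = just (α⊆E x)
    α⊆E⁺ nothing  = nothing

module _ {ℓ} (F : Frame ℓ) (P : Frame.X F → Set ℓ) where
  open Frame F

  subframe : (∀ {x} → P x → P (α x)) → (∀ {x y} → α x ≈X y → P y → P x) →
             Frame ℓ
  subframe P-α P-α⁻¹ = record
    { X       = Σ X P
    ; _≈X_    = _≈X_ on proj₁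
    ; _≤_     = _≤_ on proj₁
    ; isPO    = On.isPartialOrder proj₁ isPO
    ; E       = E on proj₁
    ; E-equiv = On.isEquivalence proj₁ E-equiv
    ; ≤⊆E     = ≤⊆E
    ; α       = λ (x , p) → α x , P-α p
    ; α-cong  = α-cong
    ; α-mono  = α-mono
    ; α-refl  = α-refl
    ; α-surj  = λ (y , q) → let (x , αx≈y) = α-surj y in (x , P-α⁻¹ αx≈y q) , αx≈y
    ; α⊆E     = λ (x , _) → α⊆E x
    }

module _ {ℓ} {I : Set ℓ} {U : (I → Set ℓ) → Set ℓ} (isU : IsUltrafilter U) where
  open UltrafilterProperties isU

  ultraproductFrame : (I → Frame ℓ) → Frame ℓ
  ultraproductFrame G = record
    { X       = ∀ j → X j
    ; _≈X_    = large _≈X_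
    ; _≤_     = large _≤_
    ; isPO    = record
      { isPreorder = record
        { isEquivalence = record
          { refl  = everywhere (λ j → PO.Eq.refl j)
          ; sym   = upward (λ j → PO.Eq.sym j)
          ; trans = upward₂ (λ j → PO.Eq.trans j)
          }
        ; reflexive     = upward (λ j → PO.reflexive j)
        ; trans         = upward₂ (λ j → PO.trans j)
        }
      ; antisym    = upward₂ (λ j → PO.antisym j)
      }
    ; E       = large E
    ; E-equiv = record
      { refl  = everywhere (λ j → Eq.refl j)
      ; sym   = upward (λ j → Eq.sym j)
      ; trans = upward₂ (λ j → Eq.trans j)
      }
    ; ≤⊆E     = upward (λ j → ≤⊆E j)
    ; α       = λ x j → α j (x j)
    ; α-cong  = upward (λ j → α-cong j)
    ; α-mono  = upward (λ j → α-mono j)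
    ; α-refl  = upward (λ j → α-refl j)
    ; α-surj  = λ y → (λ j → proj₁ (α-surj j (y j)))
                    , everywhere (λ j → proj₂ (α-surj j (y j)))
    ; α⊆E     = λ x → everywhere (λ j → α⊆E j (x j))
    }
    where
    open module G (j : I) = Frame (G j)
    module PO (j : I) = IsPartialOrder (isPO j)
    module Eq (j : I) = IsEquivalence (E-equiv j)
    large : (∀ j → Rel (X j) ℓ) → Rel (∀ j → X j) ℓ
    large R x y = U (λ j → R j (x j) (y j))

module PointedEmbedding {ℓ} {A : RawDInFL ℓ} {F : Frame ℓ}
                        {h : RawDInFL.Carrier A → Rel (Frame.X F) ℓ}
                        (e : IsEmbedding A F h) where
  open RawDInFL A
  open Frame F
  private
    module e = IsEmbedding e
    module F⁺ = Frame (adjoinPoint F)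

  h⁺ : Carrier → Rel (Maybe X) ℓ
  h⁺ a = Pointwise (h a)

  h⁺-up : ∀ a → F⁺.IsUp (h⁺ a)
  h⁺-up a = (λ _ _ → pointwise-map (λ {x} {y} → proj₁ (e.up a) x y)) , closed
    where
    closed : ∀ m₁ n₁ m n → h⁺ a m₁ n₁ → Pointwise E m n →
             Pointwise _≤_ m m₁ → Pointwise _≤_ n₁ n → h⁺ a m n
    closed (just u) (just v) (just x) (just y) (just r) (just q) (just p) (just s) =
      just (proj₂ (e.up a) u v x y r q p s)
    closed nothing nothing nothing nothing nothing nothing nothing nothing = nothing

  h⁺-cong : ∀ {a b} → a ≈ b → F⁺._≐_ (h⁺ a) (h⁺ b)
  h⁺-cong {a} {b} a≈b _ _ = pointwise-map (λ {x} {y} → proj₁ (e.cong a b a≈b x y))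
                          , pointwise-map (λ {x} {y} → proj₂ (e.cong a b a≈b x y))

  h⁺-∧ : ∀ a b → F⁺._≐_ (h⁺ (a ∧ b)) (h⁺ a F⁺.∩ʳ h⁺ b)
  h⁺-∧ a b _ _ = split , join
    where
    split : ∀ {m n} → h⁺ (a ∧ b) m n → (h⁺ a F⁺.∩ʳ h⁺ b) m n
    split (just r) = let (p , q) = proj₁ (e.hom-∧ a b _ _) r in just p , just q
    split nothing  = nothing , nothing
    join : ∀ {m n} → (h⁺ a F⁺.∩ʳ h⁺ b) m n → h⁺ (a ∧ b) m n
    join (just p , just q)   = just (proj₂ (e.hom-∧ a b _ _) (p , q))
    join (nothing , nothing) = nothing

  h⁺-∨ : ∀ a b → F⁺._≐_ (h⁺ (a ∨ b)) (h⁺ a F⁺.∪ʳ h⁺ b)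
  h⁺-∨ a b _ _ = split , join
    where
    split : ∀ {m n} → h⁺ (a ∨ b) m n → (h⁺ a F⁺.∪ʳ h⁺ b) m n
    split (just r) = Sum.map just just (proj₁ (e.hom-∨ a b _ _) r)
    split nothing  = inj₁ nothing
    join : ∀ {m n} → (h⁺ a F⁺.∪ʳ h⁺ b) m n → h⁺ (a ∨ b) m n
    join (inj₁ (just p)) = just (proj₂ (e.hom-∨ a b _ _) (inj₁ p))
    join (inj₁ nothing)  = nothing
    join (inj₂ (just q)) = just (proj₂ (e.hom-∨ a b _ _) (inj₂ q))
    join (inj₂ nothing)  = nothing

  h⁺-· : ∀ a b → F⁺._≐_ (h⁺ (a · b)) (h⁺ a F⁺.∘ʳ h⁺ b)
  h⁺-· a b _ _ = split , join
    where
    split : ∀ {m n} → h⁺ (a · b) m n → (h⁺ a F⁺.∘ʳ h⁺ b) m n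
    split (just r) = let (z , p , q) = proj₁ (e.hom-· a b _ _) r in just z , just p , just q
    split nothing  = nothing , nothing , nothing
    join : ∀ {m n} → (h⁺ a F⁺.∘ʳ h⁺ b) m n → h⁺ (a · b) m n
    join (just z , just p , just q)    = just (proj₂ (e.hom-· a b _ _) (z , p , q))
    join (nothing , nothing , nothing) = nothing

  h⁺-one : F⁺._≐_ (h⁺ one) F⁺._≤_
  h⁺-one _ _ = pointwise-map (λ {x} {y} → proj₁ (e.hom-one x y))
             , pointwise-map (λ {x} {y} → proj₂ (e.hom-one x y))

  h⁺-∼-intro : ∀ a {m n} → F⁺.∼ʳ (h⁺ a) m n → h⁺ (∼ a) m n
  h⁺-∼-intro a (just z , (just q , ¬r) , just p) =
    just (proj₂ (e.hom-∼ a _ _) (z , (q , λ r → ¬r (just r)) , p))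
  h⁺-∼-intro a (nothing , (nothing , ¬r) , nothing) = ⊥-elim (¬r nothing)

  h⁺-∼-elim : ∀ a {m n} → IsJust m → h⁺ (∼ a) m n → F⁺.∼ʳ (h⁺ a) m n
  h⁺-∼-elim a just (just r) =
    let (z , (q , ¬r) , p) = proj₁ (e.hom-∼ a _ _) r
    in just z , (just q , λ { (just r) → ¬r r }) , just p

  h⁺-−-intro : ∀ a {m n} → F⁺.−ʳ (h⁺ a) m n → h⁺ (− a) m n
  h⁺-−-intro a {just _} (just z , just p , just q , ¬r) =
    just (proj₂ (e.hom-− a _ _) (z , p , q , λ r → ¬r (just r)))
  h⁺-−-intro a {nothing} (nothing , nothing , nothing , ¬r) = ⊥-elim (¬r nothing)

  h⁺-−-elim : ∀ a {m n} → IsJust m → h⁺ (− a) m n → F⁺.−ʳ (h⁺ a) m n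
  h⁺-−-elim a just (just r) =
    let (z , p , q , ¬r) = proj₁ (e.hom-− a _ _) r
    in just z , just p , just q , λ { (just r) → ¬r r }

  h⁺-separates : ExcludedMiddle ℓ → ∀ {a b} → ¬ a ≈ b →
                 Σ (Maybe X × Maybe X) λ (m , n) → (h⁺ a ⊖ h⁺ b) m n
  h⁺-separates em {a} {b} a≉b = dne λ ¬sep → a≉b (e.inj a b λ x y →
      (λ r → dne λ ¬s → ¬sep ((just x , just y) , inj₁ (just r , λ { (just s) → ¬s s })))
    , (λ s → dne λ ¬r → ¬sep ((just x , just y) , inj₂ (just s , λ { (just r) → ¬r r }))))
    where
    dne : DoubleNegationElimination ℓ
    dne = em⇒dne em

module UltraproductEmbedding {ℓ} (em : ExcludedMiddle ℓ) {I : Set ℓ}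
                             {U : (I → Set ℓ) → Set ℓ} (isU : IsUltrafilter U)
                             (A : I → RawDInFL ℓ) (rep : ∀ j → Representable (A j)) where
  open UltrafilterProperties isU
  module A (j : I) = RawDInFL (A j)
  module P = RawDInFL (Ultraproduct I U A)
  module Pointed (j : I) = PointedEmbedding (proj₂ (proj₂ (rep j)))

  F : I → Frame ℓ
  F j = proj₁ (rep j)

  -- Without this restriction ∼ and − would not be preserved: h⁺ (∼ a) relates the adjoined
  -- point to itself, whereas ∼ʳ (h⁺ a) does not.
  IsGerm : (∀ j → Maybe (Frame.X (F j))) → Set ℓ
  IsGerm x = U (λ j → IsJust (x j))

  germFrame : Frame ℓ
  germFrame = subframe (ultraproductFrame isU (λ j → adjoinPoint (F j))) IsGerm
                       (upward (λ j → isJust-map))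
                       (upward₂ (λ j αx≈y y-just →
                                   isJust-map⁻ (pointwise-isJustˡ αx≈y y-just)))

  open Frame germFrame

  H : P.Carrier → Rel X ℓ
  H a (x , _) (y , _) = U (λ j → Pointed.h⁺ j (a j) (x j) (y j))

  H-separates : ∀ a b → U (λ j → ¬ A._≈_ j (a j) (b j)) →
                Σ (X × X) λ (x , y) → (H a ⊖ H b) x y
  H-separates a b a≉b =
    let (xy , u) = choice em (λ _ → nothing , nothing)
                          (upward (λ j → Pointed.h⁺-separates j em) a≉b)
    in ( ((λ j → proj₁ (xy j)) , upward (λ j → proj₁ ∘ pointwise-⊖-isJust) u)
       , ((λ j → proj₂ (xy j)) , upward (λ j → proj₂ ∘ pointwise-⊖-isJust) u) )
       , Sum.map large-∖ large-∖ (large-⊎ u)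

  H-injective : ∀ a b → H a ≐ H b → a P.≈ b
  H-injective a b Ha≐Hb with ultra (λ j → A._≈_ j (a j) (b j))
  ... | inj₁ a≈b = a≈b
  ... | inj₂ a≉b with H-separates a b a≉b
  ...   | (x , y) , inj₁ (r , ¬s) = ⊥-elim (¬s (proj₁ (Ha≐Hb x y) r))
  ...   | (x , y) , inj₂ (s , ¬r) = ⊥-elim (¬r (proj₂ (Ha≐Hb x y) s))

  H-·-split : ∀ a b x y → H (a P.· b) x y → (H a ∘ʳ H b) x y
  H-·-split a b (x , x-germ) _ r =
    let (z , u) = choice em (λ _ → nothing)
                         (upward (λ j → proj₁ (Pointed.h⁺-· j (a j) (b j) _ _)) r)
    in (z , upward₂ (λ j x-just (p , _) → pointwise-isJustʳ p x-just) x-germ u)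
       , upward (λ j → proj₁) u , upward (λ j → proj₂) u

  H-∼-split : ∀ a x y → H (P.∼ a) x y → ∼ʳ (H a) x y
  H-∼-split a (x , x-germ) _ r =
    let (z , u) = choice em (λ _ → nothing)
                         (upward₂ (λ j → Pointed.h⁺-∼-elim j (a j)) x-germ r)
    in (z , upward₂ (λ j x-just ((q , _) , _) → pointwise-isJustˡ q x-just) x-germ u)
       , large-∖ (upward (λ j → proj₁) u)
       , upward (λ j → proj₂) u

  H-−-split : ∀ a x y → H (P.− a) x y → −ʳ (H a) x y
  H-−-split a (x , x-germ) (_ , y-germ) r =
    let (z , u) = choice em (λ _ → nothing)
                         (upward₂ (λ j → Pointed.h⁺-−-elim j (a j)) x-germ r)
    in (z , upward₂ (λ j y-just (_ , q , _) → pointwise-isJustʳ q y-just) y-germ u)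
       , upward (λ j → proj₁) u
       , large-∖ (upward (λ j → proj₂) u)

  H-∼-join : ∀ a x y → ∼ʳ (H a) x y → H (P.∼ a) x y
  H-∼-join a _ _ ((z , _) , (q , ¬r) , p) =
    upward₃ (λ j q ¬r p → Pointed.h⁺-∼-intro j (a j) (z j , (q , ¬r) , p)) q (large-¬ ¬r) p

  H-−-join : ∀ a x y → −ʳ (H a) x y → H (P.− a) x y
  H-−-join a _ _ ((z , _) , p , q , ¬r) =
    upward₃ (λ j p q ¬r → Pointed.h⁺-−-intro j (a j) (z j , p , q , ¬r)) p q (large-¬ ¬r)

  H-embedding : IsEmbedding (Ultraproduct I U A) germFrame H
  H-embedding = record
    { up      = λ a → (λ _ _ → upward (λ j → proj₁ (Pointed.h⁺-up j (a j)) _ _))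
                    , (λ _ _ _ _ → upward₄ (λ j → proj₂ (Pointed.h⁺-up j (a j)) _ _ _ _))
    ; cong    = λ a b a≈b _ _ → upward₂ (λ j e → proj₁ (Pointed.h⁺-cong j e _ _)) a≈b
                              , upward₂ (λ j e → proj₂ (Pointed.h⁺-cong j e _ _)) a≈b
    ; inj     = H-injective
    ; hom-∧   = λ a b _ _ →
        (λ r → upward (λ j → proj₁ ∘ proj₁ (Pointed.h⁺-∧ j (a j) (b j) _ _)) r
             , upward (λ j → proj₂ ∘ proj₁ (Pointed.h⁺-∧ j (a j) (b j) _ _)) r)
      , (λ (r , s) → upward₂ (λ j p q → proj₂ (Pointed.h⁺-∧ j (a j) (b j) _ _) (p , q)) r s)
    ; hom-∨   = λ a b _ _ →
        (λ r → large-⊎ (upward (λ j → proj₁ (Pointed.h⁺-∨ j (a j) (b j) _ _)) r))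
      , Sum.[ upward (λ j p → proj₂ (Pointed.h⁺-∨ j (a j) (b j) _ _) (inj₁ p))
            , upward (λ j q → proj₂ (Pointed.h⁺-∨ j (a j) (b j) _ _) (inj₂ q)) ]
    ; hom-·   = λ a b x y → H-·-split a b x y
      , (λ (_ , r , s) →
           upward₂ (λ j p q → proj₂ (Pointed.h⁺-· j (a j) (b j) _ _) (_ , p , q)) r s)
    ; hom-one = λ _ _ → upward (λ j → proj₁ (Pointed.h⁺-one j _ _))
                      , upward (λ j → proj₂ (Pointed.h⁺-one j _ _))
    ; hom-∼   = λ a x y → H-∼-split a x y , H-∼-join a x y
    ; hom-−   = λ a x y → H-−-split a x y , H-−-join a x y
    }

ultraproduct-representable : ∀ {ℓ} → ExcludedMiddle ℓ →
                             {I : Set ℓ} {U : (I → Set ℓ) → Set ℓ} → IsUltrafilter U →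
                             (A : I → RawDInFL ℓ) → (∀ j → Representable (A j)) →
                             Representable (Ultraproduct I U A)
ultraproduct-representable em isU A rep = germFrame , H , H-embedding
  where open UltraproductEmbedding em isU A rep

module _ {ℓ : Level} where

  principal : (Lift ℓ ⊤ → Set ℓ) → Set ℓ
  principal S = S (lift tt)

  principal-isUltrafilter : ExcludedMiddle ℓ → IsUltrafilter principal
  principal-isUltrafilter em = record
    { whole  = lift tt
    ; proper = lower
    ; upward = λ S⊆T → S⊆T (lift tt)
    ; meet   = _,_
    ; ultra  = λ _ → toSum em
    }

  -- RawDInFL imposes no laws: reflexivity of ≈ is read off from injectivity of a representation.
  representable-≈-refl : (B : RawDInFL ℓ) → Representable B → ∀ b → RawDInFL._≈_ B b b
  representable-≈-refl B (_ , _ , e) b =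
    IsEmbedding.inj e b b λ _ _ → (λ r → r) , (λ r → r)

  principal-ultrapower-iso : (B : RawDInFL ℓ) → Representable B →
                             Iso (Ultraproduct (Lift ℓ ⊤) principal (λ _ → B)) B
  principal-ultrapower-iso B rep = record
    { f       = λ b → b (lift tt)
    ; cong    = λ _ _ b≈c → b≈c
    ; inj     = λ _ _ b≈c → b≈c
    ; surj    = λ b → (λ _ → b) , refl b
    ; hom-∧   = λ _ _ → refl _
    ; hom-∨   = λ _ _ → refl _
    ; hom-·   = λ _ _ → refl _
    ; hom-one = refl _
    ; hom-∼   = λ _ → refl _
    ; hom-−   = λ _ → refl _
    }
    where
    refl : ∀ b → RawDInFL._≈_ B b b
    refl = representable-≈-refl B rep

theorem4p9 : ∀ {ℓ : Level} → ExcludedMiddle ℓ →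
    ((I : Set ℓ) (U : (I → Set ℓ) → Set ℓ) → IsUltrafilter U →
      (A : I → RawDInFL ℓ) → (∀ j → Representable (A j)) →
      Representable (Ultraproduct I U A))
    × ((B : RawDInFL ℓ) → Representable B →
      Σ (Set ℓ) λ I → Σ ((I → Set ℓ) → Set ℓ) λ U → IsUltrafilter U ×
        Σ (I → RawDInFL ℓ) λ A → (∀ j → Representable (A j)) ×
          Iso (Ultraproduct I U A) B)
theorem4p9 em =
    (λ _ _ isU A rep → ultraproduct-representable em isU A rep)
  , (λ B rep → Lift _ ⊤ , principal , principal-isUltrafilter em
             , (λ _ → B) , (λ _ → rep) , principal-ultrapower-iso B rep)
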